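{- Let $(\mathcal{C},\otimes,I)$ be a symmetric monoidal category with a reciprocal orthogonality relative to an object $J$. Then the orthogonality stabilises the monoidal product: for all objects $R,S$ and all $U\subseteq\mathcal{C}(I,R)$, $V\subseteq\mathcal{C}(I,S)$, $$(U^{\circ\circ}\otimes V^{\circ\circ})^\circ=(U^{\circ\circ}\otimes V)^\circ=(U\otimes V^{\circ\circ})^\circ.$$
   Context: A reciprocal orthogonality relative to $J$ is a family of relations $\perp_R\subseteq\mathcal{C}(I,R)\times\mathcal{C}(R,J)$ such that for all $u:I\to R$, $f:R\to S$, $x:S\to J$: $u\perp_R x\circ f$ iff $f\circ u\perp_S x$. For $U\subseteq\mathcal{C}(I,R)$, $U^\circ=\{x\in\mathcal{C}(R,J):\forall u\in U,\ u\perp_Rx\}$; for $X\subseteq\mathcal{C}(R,J)$, $X^\circ=\{u\in\mathcal{C}(I,R):\forall x\in X,\ u\perp_Rx\}$. For $u:I\to R$, $v:I\to S$, $u\otimes v$ is $I\cong I\otimes I\xrightarrow{u\otimes v}R\otimes S$, and $U\otimes V=\{u\otimes v:u\in U,v\in V\}$. -}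

module Defs where

open import Level using (Level; _⊔_; suc)
open import Data.Product using (Σ; _×_; ∃-syntax)
open import Relation.Binary.PropositionalEquality using (_≡_)
open import Relation.Unary using (Pred)

record SymmetricMonoidalCategory (o ℓ : Level) : Set (suc (o ⊔ ℓ)) where
  infixr 9 _∘_
  infixr 10 _⊗₀_ _⊗₁_
  field
    Obj : Set o
    Hom : Obj → Obj → Set ℓ
    id  : ∀ {A} → Hom A A
    _∘_ : ∀ {A B C} → Hom B C → Hom A B → Hom A C
    identityˡ : ∀ {A B} {f : Hom A B} → id ∘ f ≡ f
    identityʳ : ∀ {A B} {f : Hom A B} → f ∘ id ≡ f
    assoc : ∀ {A B C D} {f : Hom A B} {g : Hom B C} {h : Hom C D} →
            (h ∘ g) ∘ f ≡ h ∘ (g ∘ f)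
    _⊗₀_ : Obj → Obj → Obj
    _⊗₁_ : ∀ {A B C D} → Hom A B → Hom C D → Hom (A ⊗₀ C) (B ⊗₀ D)
    ⊗-identity : ∀ {A B} → id {A} ⊗₁ id {B} ≡ id
    ⊗-homomorphism : ∀ {A B C D E F} {f : Hom A B} {g : Hom B C}
                       {h : Hom D E} {k : Hom E F} →
                     (g ∘ f) ⊗₁ (k ∘ h) ≡ (g ⊗₁ k) ∘ (f ⊗₁ h)
    unit : Obj
    λ⇒ : ∀ {A} → Hom (unit ⊗₀ A) A
    λ⇐ : ∀ {A} → Hom A (unit ⊗₀ A)
    λ-isoˡ : ∀ {A} → λ⇐ {A} ∘ λ⇒ ≡ id
    λ-isoʳ : ∀ {A} → λ⇒ {A} ∘ λ⇐ ≡ id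
    λ-natural : ∀ {A B} {f : Hom A B} → f ∘ λ⇒ ≡ λ⇒ ∘ (id ⊗₁ f)
    ρ⇒ : ∀ {A} → Hom (A ⊗₀ unit) A
    ρ⇐ : ∀ {A} → Hom A (A ⊗₀ unit)
    ρ-isoˡ : ∀ {A} → ρ⇐ {A} ∘ ρ⇒ ≡ id
    ρ-isoʳ : ∀ {A} → ρ⇒ {A} ∘ ρ⇐ ≡ id
    ρ-natural : ∀ {A B} {f : Hom A B} → f ∘ ρ⇒ ≡ ρ⇒ ∘ (f ⊗₁ id)
    α⇒ : ∀ {A B C} → Hom ((A ⊗₀ B) ⊗₀ C) (A ⊗₀ (B ⊗₀ C))
    α⇐ : ∀ {A B C} → Hom (A ⊗₀ (B ⊗₀ C)) ((A ⊗₀ B) ⊗₀ C)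
    α-isoˡ : ∀ {A B C} → α⇐ {A} {B} {C} ∘ α⇒ ≡ id
    α-isoʳ : ∀ {A B C} → α⇒ {A} {B} {C} ∘ α⇐ ≡ id
    α-natural : ∀ {A A′ B B′ C C′} {f : Hom A A′} {g : Hom B B′} {h : Hom C C′} →
                α⇒ ∘ ((f ⊗₁ g) ⊗₁ h) ≡ (f ⊗₁ (g ⊗₁ h)) ∘ α⇒
    triangle : ∀ {A B} → (id {A} ⊗₁ λ⇒ {B}) ∘ α⇒ ≡ ρ⇒ ⊗₁ id
    pentagon : ∀ {A B C D} →
               (id {A} ⊗₁ α⇒ {B} {C} {D}) ∘ α⇒ ∘ (α⇒ ⊗₁ id) ≡ α⇒ ∘ α⇒
    σ : ∀ {A B} → Hom (A ⊗₀ B) (B ⊗₀ A)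
    σ-natural : ∀ {A A′ B B′} {f : Hom A A′} {g : Hom B B′} →
                σ ∘ (f ⊗₁ g) ≡ (g ⊗₁ f) ∘ σ
    σ-involutive : ∀ {A B} → σ {B} {A} ∘ σ {A} {B} ≡ id
    hexagon : ∀ {A B C} →
              α⇒ {B} {C} {A} ∘ σ ∘ α⇒ ≡ (id ⊗₁ σ) ∘ α⇒ ∘ (σ ⊗₁ id)

module _ {o ℓ : Level} (𝒞 : SymmetricMonoidalCategory o ℓ) where
  open SymmetricMonoidalCategory 𝒞

  record ReciprocalOrthogonality (J : Obj) (r : Level) : Set (o ⊔ ℓ ⊔ suc r) where
    field
      _⊥_ : ∀ {R} → Hom unit R → Hom R J → Set r
      reciprocal→ : ∀ {R S} (u : Hom unit R) (f : Hom R S) (x : Hom S J) →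
                    u ⊥ (x ∘ f) → (f ∘ u) ⊥ x
      reciprocal← : ∀ {R S} (u : Hom unit R) (f : Hom R S) (x : Hom S J) →
                    (f ∘ u) ⊥ x → u ⊥ (x ∘ f)

  -- u ⊗ v : I ≅ I ⊗ I → R ⊗ S  (using λ⇐ at I as the iso I ≅ I ⊗ I)
  _⊗ₚ_ : ∀ {R S} → Hom unit R → Hom unit S → Hom unit (R ⊗₀ S)
  u ⊗ₚ v = (u ⊗₁ v) ∘ λ⇐

  _⊗ˢ_ : ∀ {R S p q} → Pred (Hom unit R) p → Pred (Hom unit S) q →
         Pred (Hom unit (R ⊗₀ S)) (ℓ ⊔ p ⊔ q)
  (U ⊗ˢ V) w = ∃[ u ] ∃[ v ] (U u × V v × w ≡ u ⊗ₚ v)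

  module Orth {J : Obj} {r : Level} (O : ReciprocalOrthogonality J r) where
    open ReciprocalOrthogonality O

    _° : ∀ {R p} → Pred (Hom unit R) p → Pred (Hom R J) (ℓ ⊔ p ⊔ r)
    (U °) x = ∀ u → U u → u ⊥ x

    _°′ : ∀ {R p} → Pred (Hom R J) p → Pred (Hom unit R) (ℓ ⊔ p ⊔ r)
    (X °′) u = ∀ x → X x → u ⊥ x

    _°° : ∀ {R p} → Pred (Hom unit R) p → Pred (Hom unit R) (ℓ ⊔ p ⊔ r)
    U °° = (U °) °′

{-# OPTIONS --safe #-}
-- Since u ⊗ v = (id ⊗ v ∘ ρ⁻¹) ∘ u (this uses Kelly's coherence λ_I = ρ_I),
-- for fixed v the u ⊗ v with u ∈ U form the image of U under g = id ⊗ v ∘ ρ⁻¹.  By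
-- reciprocity, x is orthogonal to that image iff x ∘ g ∈ U°, and then x is
-- orthogonal to the image of U°° as well.  So replacing U by U°° does not
-- change the orthogonal of U ⊗ V; symmetrically on the right.
module Submission where

open import Defs
open import Level using (Level)
open import Data.Product using (_×_; _,_)
open import Relation.Unary using (Pred; _⊆_; _≐_)
open import Relation.Unary.Properties using (≐-sym; ≐-trans)
open import Relation.Binary.PropositionalEquality
open ≡-Reasoning

module Coherence {o ℓ : Level} (𝒞 : SymmetricMonoidalCategory o ℓ) where
  open SymmetricMonoidalCategory 𝒞

  cancelʳ : ∀ {A B C} {f g : Hom B C} (i : Hom A B) (i⁻¹ : Hom B A) →
            i ∘ i⁻¹ ≡ id → f ∘ i ≡ g ∘ i → f ≡ g
  cancelʳ {f = f} {g} i i⁻¹ inv eq = begin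
    f                ≡⟨ sym identityʳ ⟩
    f ∘ id           ≡⟨ cong (f ∘_) (sym inv) ⟩
    f ∘ (i ∘ i⁻¹)    ≡⟨ sym assoc ⟩
    (f ∘ i) ∘ i⁻¹    ≡⟨ cong (_∘ i⁻¹) eq ⟩
    (g ∘ i) ∘ i⁻¹    ≡⟨ assoc ⟩
    g ∘ (i ∘ i⁻¹)    ≡⟨ cong (g ∘_) inv ⟩
    g ∘ id           ≡⟨ identityʳ ⟩
    g                ∎

  cancelˡ : ∀ {A B C} {f g : Hom A B} (i : Hom B C) (i⁻¹ : Hom C B) →
            i⁻¹ ∘ i ≡ id → i ∘ f ≡ i ∘ g → f ≡ g
  cancelˡ {f = f} {g} i i⁻¹ inv eq = begin
    f                ≡⟨ sym identityˡ ⟩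
    id ∘ f           ≡⟨ cong (_∘ f) (sym inv) ⟩
    (i⁻¹ ∘ i) ∘ f    ≡⟨ assoc ⟩
    i⁻¹ ∘ (i ∘ f)    ≡⟨ cong (i⁻¹ ∘_) eq ⟩
    i⁻¹ ∘ (i ∘ g)    ≡⟨ sym assoc ⟩
    (i⁻¹ ∘ i) ∘ g    ≡⟨ cong (_∘ g) inv ⟩
    id ∘ g           ≡⟨ identityˡ ⟩
    g                ∎

  inverse-natural : ∀ {X A Y B} {i : Hom X A} {i⁻¹ : Hom A X}
                    {j : Hom Y B} {j⁻¹ : Hom B Y} {f : Hom A B} {g : Hom X Y} →
                    i ∘ i⁻¹ ≡ id → j⁻¹ ∘ j ≡ id →
                    f ∘ i ≡ j ∘ g → j⁻¹ ∘ f ≡ g ∘ i⁻¹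
  inverse-natural {i = i} {i⁻¹} {j} {j⁻¹} {f} {g} i-inv j-inv nat = begin
    j⁻¹ ∘ f                ≡⟨ cong (j⁻¹ ∘_) (sym identityʳ) ⟩
    j⁻¹ ∘ f ∘ id           ≡⟨ cong (λ h → j⁻¹ ∘ f ∘ h) (sym i-inv) ⟩
    j⁻¹ ∘ f ∘ i ∘ i⁻¹      ≡⟨ cong (j⁻¹ ∘_) (sym assoc) ⟩
    j⁻¹ ∘ (f ∘ i) ∘ i⁻¹    ≡⟨ cong (λ h → j⁻¹ ∘ h ∘ i⁻¹) nat ⟩
    j⁻¹ ∘ (j ∘ g) ∘ i⁻¹    ≡⟨ cong (j⁻¹ ∘_) assoc ⟩
    j⁻¹ ∘ j ∘ g ∘ i⁻¹      ≡⟨ sym assoc ⟩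
    (j⁻¹ ∘ j) ∘ g ∘ i⁻¹    ≡⟨ cong (_∘ (g ∘ i⁻¹)) j-inv ⟩
    id ∘ g ∘ i⁻¹           ≡⟨ identityˡ ⟩
    g ∘ i⁻¹                ∎

  ⊗id-homomorphism : ∀ {A B C D} {f : Hom A B} {g : Hom B C} →
                     (g ∘ f) ⊗₁ id {D} ≡ (g ⊗₁ id) ∘ (f ⊗₁ id)
  ⊗id-homomorphism = trans (cong (_ ⊗₁_) (sym identityˡ)) ⊗-homomorphism

  id⊗-homomorphism : ∀ {A B C D} {f : Hom A B} {g : Hom B C} →
                     id {D} ⊗₁ (g ∘ f) ≡ (id ⊗₁ g) ∘ (id ⊗₁ f)
  id⊗-homomorphism = trans (cong (_⊗₁ _) (sym identityˡ)) ⊗-homomorphism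

  ⊗-split : ∀ {A B C D} (f : Hom A B) (g : Hom C D) → f ⊗₁ g ≡ (id ⊗₁ g) ∘ (f ⊗₁ id)
  ⊗-split f g = trans (cong₂ _⊗₁_ (sym identityˡ) (sym identityʳ)) ⊗-homomorphism

  ⊗-split′ : ∀ {A B C D} (f : Hom A B) (g : Hom C D) → f ⊗₁ g ≡ (f ⊗₁ id) ∘ (id ⊗₁ g)
  ⊗-split′ f g = trans (cong₂ _⊗₁_ (sym identityʳ) (sym identityˡ)) ⊗-homomorphism

  id⊗-injective : ∀ {A B} {f g : Hom A B} → id {unit} ⊗₁ f ≡ id ⊗₁ g → f ≡ g
  id⊗-injective eq = cancelʳ λ⇒ λ⇐ λ-isoʳ
    (trans λ-natural (trans (cong (λ⇒ ∘_) eq) (sym λ-natural)))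

  ⊗id-injective : ∀ {A B} {f g : Hom A B} → f ⊗₁ id {unit} ≡ g ⊗₁ id → f ≡ g
  ⊗id-injective eq = cancelʳ ρ⇒ ρ⇐ ρ-isoʳ
    (trans ρ-natural (trans (cong (ρ⇒ ∘_) eq) (sym ρ-natural)))

  pentagon-λ : ∀ {X A B} →
               (id {X} ⊗₁ (λ⇒ {A ⊗₀ B} ∘ α⇒)) ∘ α⇒ ∘ (α⇒ ⊗₁ id) ≡ (ρ⇒ ⊗₁ id) ∘ α⇒
  pentagon-λ = begin
    (id ⊗₁ (λ⇒ ∘ α⇒)) ∘ α⇒ ∘ (α⇒ ⊗₁ id)          ≡⟨ cong (_∘ (α⇒ ∘ (α⇒ ⊗₁ id))) id⊗-homomorphism ⟩
    ((id ⊗₁ λ⇒) ∘ (id ⊗₁ α⇒)) ∘ α⇒ ∘ (α⇒ ⊗₁ id)  ≡⟨ assoc ⟩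
    (id ⊗₁ λ⇒) ∘ (id ⊗₁ α⇒) ∘ α⇒ ∘ (α⇒ ⊗₁ id)    ≡⟨ cong ((id ⊗₁ λ⇒) ∘_) pentagon ⟩
    (id ⊗₁ λ⇒) ∘ α⇒ ∘ α⇒                          ≡⟨ sym assoc ⟩
    ((id ⊗₁ λ⇒) ∘ α⇒) ∘ α⇒                        ≡⟨ cong (_∘ α⇒) triangle ⟩
    (ρ⇒ ⊗₁ id) ∘ α⇒                               ∎

  triangle-λ⊗id : ∀ {X A B} →
                  (id {X} ⊗₁ (λ⇒ {A} ⊗₁ id {B})) ∘ α⇒ ∘ (α⇒ ⊗₁ id) ≡ (ρ⇒ ⊗₁ id) ∘ α⇒
  triangle-λ⊗id = begin
    (id ⊗₁ (λ⇒ ⊗₁ id)) ∘ α⇒ ∘ (α⇒ ⊗₁ id)    ≡⟨ sym assoc ⟩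
    ((id ⊗₁ (λ⇒ ⊗₁ id)) ∘ α⇒) ∘ (α⇒ ⊗₁ id)  ≡⟨ cong (_∘ (α⇒ ⊗₁ id)) (sym α-natural) ⟩
    (α⇒ ∘ ((id ⊗₁ λ⇒) ⊗₁ id)) ∘ (α⇒ ⊗₁ id)  ≡⟨ assoc ⟩
    α⇒ ∘ ((id ⊗₁ λ⇒) ⊗₁ id) ∘ (α⇒ ⊗₁ id)    ≡⟨ cong (α⇒ ∘_) (sym ⊗id-homomorphism) ⟩
    α⇒ ∘ (((id ⊗₁ λ⇒) ∘ α⇒) ⊗₁ id)          ≡⟨ cong (λ h → α⇒ ∘ (h ⊗₁ id)) triangle ⟩
    α⇒ ∘ ((ρ⇒ ⊗₁ id) ⊗₁ id)                 ≡⟨ α-natural ⟩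
    (ρ⇒ ⊗₁ (id ⊗₁ id)) ∘ α⇒                 ≡⟨ cong (λ h → (ρ⇒ ⊗₁ h) ∘ α⇒) ⊗-identity ⟩
    (ρ⇒ ⊗₁ id) ∘ α⇒                         ∎

  α⇒⊗id-isoʳ : ∀ {A B C D} → (α⇒ {A} {B} {C} ⊗₁ id {D}) ∘ (α⇐ ⊗₁ id) ≡ id
  α⇒⊗id-isoʳ = trans (sym ⊗id-homomorphism) (trans (cong (_⊗₁ id) α-isoʳ) ⊗-identity)

  -- Kelly's argument: both sides agree after id ⊗ – and precomposition with the isomorphism α ∘ (α ⊗ id).
  λ⇒∘α⇒≡λ⇒⊗id : ∀ {A B} → λ⇒ {A ⊗₀ B} ∘ α⇒ {unit} ≡ λ⇒ ⊗₁ id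
  λ⇒∘α⇒≡λ⇒⊗id = id⊗-injective
    (cancelʳ α⇒ α⇐ α-isoʳ (cancelʳ (α⇒ ⊗₁ id) (α⇐ ⊗₁ id) α⇒⊗id-isoʳ
      (trans assoc (trans pentagon-λ (sym (trans assoc triangle-λ⊗id))))))

  λ⇒-unit⊗ : ∀ {A} → λ⇒ {unit ⊗₀ A} ≡ id ⊗₁ λ⇒
  λ⇒-unit⊗ = cancelˡ λ⇒ λ⇐ λ-isoˡ λ-natural

  λ⇒≡ρ⇒ : λ⇒ {unit} ≡ ρ⇒
  λ⇒≡ρ⇒ = ⊗id-injective
    (trans (sym λ⇒∘α⇒≡λ⇒⊗id) (trans (cong (_∘ α⇒) λ⇒-unit⊗) triangle))

  λ⇐≡ρ⇐ : λ⇐ {unit} ≡ ρ⇐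
  λ⇐≡ρ⇐ = trans (sym identityʳ) (trans
    (inverse-natural ρ-isoʳ λ-isoˡ (trans identityˡ (trans (sym λ⇒≡ρ⇒) (sym identityʳ))))
    identityˡ)

  ρ⇐-natural : ∀ {A B} {f : Hom A B} → ρ⇐ ∘ f ≡ (f ⊗₁ id) ∘ ρ⇐
  ρ⇐-natural = inverse-natural ρ-isoʳ ρ-isoˡ ρ-natural

  λ⇐-natural : ∀ {A B} {f : Hom A B} → λ⇐ ∘ f ≡ (id ⊗₁ f) ∘ λ⇐
  λ⇐-natural = inverse-natural λ-isoʳ λ-isoˡ λ-natural

  ⊗ₚ-factorˡ : ∀ {R S} (u : Hom unit R) (v : Hom unit S) →
               _⊗ₚ_ 𝒞 u v ≡ ((id ⊗₁ v) ∘ ρ⇐) ∘ u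
  ⊗ₚ-factorˡ u v = sym (begin
    ((id ⊗₁ v) ∘ ρ⇐) ∘ u          ≡⟨ assoc ⟩
    (id ⊗₁ v) ∘ ρ⇐ ∘ u            ≡⟨ cong ((id ⊗₁ v) ∘_) ρ⇐-natural ⟩
    (id ⊗₁ v) ∘ (u ⊗₁ id) ∘ ρ⇐    ≡⟨ sym assoc ⟩
    ((id ⊗₁ v) ∘ (u ⊗₁ id)) ∘ ρ⇐  ≡⟨ cong₂ _∘_ (sym (⊗-split u v)) (sym λ⇐≡ρ⇐) ⟩
    (u ⊗₁ v) ∘ λ⇐                 ∎)

  ⊗ₚ-factorʳ : ∀ {R S} (u : Hom unit R) (v : Hom unit S) →
               _⊗ₚ_ 𝒞 u v ≡ ((u ⊗₁ id) ∘ λ⇐) ∘ v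
  ⊗ₚ-factorʳ u v = sym (begin
    ((u ⊗₁ id) ∘ λ⇐) ∘ v          ≡⟨ assoc ⟩
    (u ⊗₁ id) ∘ λ⇐ ∘ v            ≡⟨ cong ((u ⊗₁ id) ∘_) λ⇐-natural ⟩
    (u ⊗₁ id) ∘ (id ⊗₁ v) ∘ λ⇐    ≡⟨ sym assoc ⟩
    ((u ⊗₁ id) ∘ (id ⊗₁ v)) ∘ λ⇐  ≡⟨ cong (_∘ λ⇐) (sym (⊗-split′ u v)) ⟩
    (u ⊗₁ v) ∘ λ⇐                 ∎)

module Stability {o ℓ r : Level} (𝒞 : SymmetricMonoidalCategory o ℓ)
    {J : SymmetricMonoidalCategory.Obj 𝒞} (O : ReciprocalOrthogonality 𝒞 J r) where
  open SymmetricMonoidalCategory 𝒞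
  open ReciprocalOrthogonality O
  open Orth 𝒞 O
  open Coherence 𝒞

  °-antitone : ∀ {R p p′} {U : Pred (Hom unit R) p} {U′ : Pred (Hom unit R) p′} →
               U ⊆ U′ → U′ ° ⊆ U °
  °-antitone U⊆U′ x∈U′° u u∈U = x∈U′° u (U⊆U′ u∈U)

  ⊆-°° : ∀ {R p} {U : Pred (Hom unit R) p} → U ⊆ U °°
  ⊆-°° {x = u} u∈U x x∈U° = x∈U° u u∈U

  ⊗ˢ-mono : ∀ {R S p p′ q q′}
            {U : Pred (Hom unit R) p} {U′ : Pred (Hom unit R) p′}
            {V : Pred (Hom unit S) q} {V′ : Pred (Hom unit S) q′} →
            U ⊆ U′ → V ⊆ V′ → _⊗ˢ_ 𝒞 U V ⊆ _⊗ˢ_ 𝒞 U′ V′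
  ⊗ˢ-mono U⊆U′ V⊆V′ (u , v , u∈U , v∈V , eq) = u , v , U⊆U′ u∈U , V⊆V′ v∈V , eq

  ⊥-image-°° : ∀ {R T p} {U : Pred (Hom unit R) p} (f : Hom R T) (x : Hom T J) →
               (∀ u → U u → (f ∘ u) ⊥ x) → ∀ u → (U °°) u → (f ∘ u) ⊥ x
  ⊥-image-°° f x f[U]⊥x u u∈U°° =
    reciprocal→ u f x (u∈U°° (x ∘ f) (λ u′ u′∈U → reciprocal← u′ f x (f[U]⊥x u′ u′∈U)))

  ⊗ˢ-°°ˡ : ∀ {R S p q} (U : Pred (Hom unit R) p) (V : Pred (Hom unit S) q) →
           (_⊗ˢ_ 𝒞 (U °°) V) ° ≐ (_⊗ˢ_ 𝒞 U V) °
  ⊗ˢ-°°ˡ U V = °-antitone (⊗ˢ-mono ⊆-°° (λ v∈V → v∈V)) , closure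
    where
    closure : (_⊗ˢ_ 𝒞 U V) ° ⊆ (_⊗ˢ_ 𝒞 (U °°) V) °
    closure {x} x∈[U⊗V]° w (u , v , u∈U°° , v∈V , refl) =
      subst (_⊥ x) (sym (⊗ₚ-factorˡ u v))
        (⊥-image-°° _ x (λ u′ u′∈U → subst (_⊥ x) (⊗ₚ-factorˡ u′ v)
                                       (x∈[U⊗V]° _ (u′ , v , u′∈U , v∈V , refl)))
                      u u∈U°°)

  ⊗ˢ-°°ʳ : ∀ {R S p q} (U : Pred (Hom unit R) p) (V : Pred (Hom unit S) q) →
           (_⊗ˢ_ 𝒞 U (V °°)) ° ≐ (_⊗ˢ_ 𝒞 U V) °
  ⊗ˢ-°°ʳ U V = °-antitone (⊗ˢ-mono (λ u∈U → u∈U) ⊆-°°) , closure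
    where
    closure : (_⊗ˢ_ 𝒞 U V) ° ⊆ (_⊗ˢ_ 𝒞 U (V °°)) °
    closure {x} x∈[U⊗V]° w (u , v , u∈U , v∈V°° , refl) =
      subst (_⊥ x) (sym (⊗ₚ-factorʳ u v))
        (⊥-image-°° _ x (λ v′ v′∈V → subst (_⊥ x) (⊗ₚ-factorʳ u v′)
                                       (x∈[U⊗V]° _ (u , v′ , u∈U , v′∈V , refl)))
                      v v∈V°°)

mainTheorem10 : ∀ {o ℓ r p q : Level} (𝒞 : SymmetricMonoidalCategory o ℓ)
    (J : SymmetricMonoidalCategory.Obj 𝒞) (O : ReciprocalOrthogonality 𝒞 J r)
    {R S : SymmetricMonoidalCategory.Obj 𝒞}
    (U : Pred (SymmetricMonoidalCategory.Hom 𝒞 (SymmetricMonoidalCategory.unit 𝒞) R) p)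
    (V : Pred (SymmetricMonoidalCategory.Hom 𝒞 (SymmetricMonoidalCategory.unit 𝒞) S) q) →
    let open Orth 𝒞 O in
    ((_⊗ˢ_ 𝒞 (U °°) (V °°)) ° ≐ (_⊗ˢ_ 𝒞 (U °°) V) °)
    × ((_⊗ˢ_ 𝒞 (U °°) V) ° ≐ (_⊗ˢ_ 𝒞 U (V °°)) °)
mainTheorem10 𝒞 J O U V =
  ⊗ˢ-°°ʳ (U °°) V , ≐-trans (⊗ˢ-°°ˡ U V) (≐-sym (⊗ˢ-°°ʳ U V))
  where
  open Orth 𝒞 O
  open Stability 𝒞 O
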